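{- Let $\mathcal B$ be a pseudometric betweenness in which $\{a,b\}$, $\{u,v\}$ and $\{x,y\}$ are three pairs of points that are pairwise $\gamma$-related. If $[axu]$ holds, then $\{a,y,u\}$ is not collinear.
   Context: A ternary relation $\mathcal B$ on a set $V$ (write $[abc]$ for $(a,b,c)\in\mathcal B$) is a pseudometric betweenness if: (M0) if $[abc]$ then $a,b,c$ are distinct; (M1) if $[abc]$ then $[cba]$; (M2) if $[abc]$ then $[bac]$ does not hold; (M3) if $[abc]$ and $[acd]$ then $[abd]$ and $[bcd]$. A set $\{a,b,c\}$ of distinct points is collinear if one of $[abc],[bca],[cab]$ holds. For distinct $a,b$: $I(a,b)=\{x : [axb]\}$, $O(a,b)=\{x : [xab] \text{ or } [abx]\}$, and the line $\overline{ab} = \{a,b\}\cup I(a,b)\cup O(a,b)$. For four distinct points, $(a,b,c,d)$ is a parallelogram if $[abc]$, $[bcd]$, $[cda]$, $[dab]$ hold; pairs $\{a,b\}$, $\{c,d\}$ are antipodal if $(a,c,b,d)$ is a parallelogram. Pairs $\{a,b\}$ and $\{x,y\}$ (with $a\ne b$, $x\ne y$, $\{a,b\}\neq\{x,y\}$) are $\gamma$-related if $\overline{ab}=\overline{xy}$, they are antipodal, and $O(a,b)=O(x,y)=\emptyset$. -}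

module Defs where

open import Level using (Level; _⊔_; suc)
open import Data.Product using (_×_; _,_)
open import Data.Sum using (_⊎_)
open import Data.Empty using (⊥)
open import Relation.Nullary using (¬_)
open import Relation.Binary.PropositionalEquality using (_≡_; _≢_)

record IsPseudometricBetweenness {v ℓ : Level} {V : Set v} (B : V → V → V → Set ℓ) : Set (v ⊔ ℓ) where
  field
    M0 : ∀ {a b c} → B a b c → (a ≢ b) × (b ≢ c) × (a ≢ c)
    M1 : ∀ {a b c} → B a b c → B c b a
    M2 : ∀ {a b c} → B a b c → ¬ B b a c
    M3 : ∀ {a b c d} → B a b c → B a c d → B a b d × B b c d

module _ {v ℓ : Level} {V : Set v} (B : V → V → V → Set ℓ) where

  Collinear : V → V → V → Set (v ⊔ ℓ)
  Collinear a b c = ((a ≢ b) × (b ≢ c) × (a ≢ c)) × (B a b c ⊎ B b c a ⊎ B c a b)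

  I : V → V → V → Set ℓ
  I a b x = B a x b

  O : V → V → V → Set ℓ
  O a b x = B x a b ⊎ B a b x

  Line : V → V → V → Set (v ⊔ ℓ)
  Line a b x = (x ≡ a) ⊎ (x ≡ b) ⊎ I a b x ⊎ O a b x

  SameSet : ∀ {m} → (V → Set m) → (V → Set m) → Set (v ⊔ m)
  SameSet P Q = ∀ x → (P x → Q x) × (Q x → P x)

  Empty : ∀ {m} → (V → Set m) → Set (v ⊔ m)
  Empty P = ∀ x → ¬ P x

  SamePair : V → V → V → V → Set v
  SamePair a b x y = ((a ≡ x) × (b ≡ y)) ⊎ ((a ≡ y) × (b ≡ x))

  Parallelogram : V → V → V → V → Set (v ⊔ ℓ)
  Parallelogram a b c d =
    ((a ≢ b) × (a ≢ c) × (a ≢ d) × (b ≢ c) × (b ≢ d) × (c ≢ d))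
    × B a b c × B b c d × B c d a × B d a b

  Antipodal : V → V → V → V → Set (v ⊔ ℓ)
  Antipodal a b c d = Parallelogram a c b d

  GammaRelated : V → V → V → V → Set (v ⊔ ℓ)
  GammaRelated a b x y =
    (a ≢ b) × (x ≢ y) × ¬ SamePair a b x y
    × SameSet (Line a b) (Line x y)
    × Antipodal a b x y
    × Empty (O a b) × Empty (O x y)

-- The parallelograms (a,u,b,v),
-- (a,x,b,y) and (u,x,v,y) give [uav], [yax], [xvy] and [vyu]; together with [axu]
-- these yield [avy]. A triple has at most one middle point, and each of [ayu], [yua],
-- [uay] produces a second middle point for {a,v,y} or {a,x,u}.
module Submission where

open import Defs
open import Level using (Level)
open import Relation.Nullary using (¬_)
open import Data.Product using (_,_; proj₁; proj₂)
open import Data.Sum using (_⊎_; inj₁; inj₂)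
open import Relation.Binary.PropositionalEquality using (refl)

module PseudometricBetweenness {v ℓ : Level} {V : Set v} {B : V → V → V → Set ℓ}
                               (isPB : IsPseudometricBetweenness B) where

  open IsPseudometricBetweenness isPB

  B-shiftʳ : ∀ {a b c d} → B a b c → B a c d → B b c d
  B-shiftʳ abc acd = proj₂ (M3 abc acd)

  ¬B-swapˡ : ∀ {a b c} → B a b c → ¬ B b a c
  ¬B-swapˡ = M2

  ¬B-swapʳ : ∀ {a b c} → B a b c → ¬ B a c b
  ¬B-swapʳ abc acb = proj₁ (proj₂ (M0 (proj₁ (M3 abc acb)))) refl

  ¬B-rotate : ∀ {a b c} → B a b c → ¬ B c a b
  ¬B-rotate abc cab = M2 abc (M1 cab)

mainTheorem14 : ∀ {v ℓ : Level} {V : Set v} (B : V → V → V → Set ℓ)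
    → IsPseudometricBetweenness B
    → (a b u v x y : V)
    → GammaRelated B a b u v
    → GammaRelated B a b x y
    → GammaRelated B u v x y
    → B a x u
    → ¬ Collinear B a y u
mainTheorem14 B isPB a b u v x y
  (_ , _ , _ , _ , (_ , _ , _ , _ , vau) , _)
  (_ , _ , _ , _ , (_ , _ , _ , _ , yax) , _)
  (_ , _ , _ , _ , (_ , _ , xvy , vyu , _) , _)
  axu (_ , collinear) = refute collinear
  where
  open IsPseudometricBetweenness isPB using (M1)
  open PseudometricBetweenness isPB

  uav : B u a v
  uav = M1 vau

  avy : B a v y
  avy = B-shiftʳ (B-shiftʳ (M1 axu) uav) xvy

  refute : ¬ (B a y u ⊎ B y u a ⊎ B u a y)
  refute (inj₁ ayu)        = ¬B-swapˡ avy (M1 (B-shiftʳ (M1 ayu) uav))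
  refute (inj₂ (inj₁ yua)) = ¬B-rotate axu (B-shiftʳ yua yax)
  refute (inj₂ (inj₂ uay)) = ¬B-swapʳ avy (B-shiftʳ uay (M1 vyu))
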